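{- Let $G$ be the $(n\times n)$-grid and let $Q\subseteq V_1$ be a pyramidal set. If $i_1(Q)\ge i_2(Q)$, then the set $Q'$ obtained from $Q$ by the left shifting is left-pyramidal and satisfies $\delta(Q')\le\delta(Q)$. If $i_1(Q)\le i_2(Q)$, then the set $Q'$ obtained from $Q$ by the right shifting is right-pyramidal and satisfies $\delta(Q')\le\delta(Q)$.
   Context: The $(n\times n)$-grid $G$ has vertex set $\{(x,y): x,y\in\mathbb Z,\ 1\le x,y\le n\}$, with $(x,y)$ adjacent to $(x',y')$ iff $|x-x'|+|y-y'|=1$. $V_1=\{(x,y): x+y \text{ even}\}$. For $S\subseteq V(G)$, $N(S)=\bigcup_{v\in S}N(v)\setminus S$ and $\delta(S)=|N(S)|$. A set $Q\subseteq V_1$ is pyramidal if for every $(x,y)\in Q$ with $y\ge2$ we have $(x-1,y-1)\in Q$ whenever $x\ge2$, and $(x+1,y-1)\in Q$ whenever $x\le n-1$. A pyramidal set $Q$ is left-pyramidal if $(x,y)\in Q$ with $x\ge3$ implies $(x-2,y)\in Q$, and right-pyramidal if $(x,y)\in Q$ with $x\le n-2$ implies $(x+2,y)\in Q$. For $i\in\{1,\ldots,n\}$, $X_i=\{(x,i):1\le x\le n\}\cap V_1$. The left shifting of $Q\subseteq V_1$ is obtained by replacing, for each $i\in\{1,\ldots,n\}$, the $r=|X_i\cap Q|$ vertices of $X_i\cap Q$ by the $r$ vertices of $X_i$ with the smallest $x$-coordinates; the right shifting replaces them by the $r$ vertices of $X_i$ with the largest $x$-coordinates. For a pyramidal $Q$,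 $i_1(Q)=0$ if $(1,y)\notin Q$ for all $y$, and otherwise $i_1(Q)=\max\{y:(1,y)\in Q\}$; similarly $i_2(Q)=0$ if $(n,y)\notin Q$ for all $y$, and otherwise $i_2(Q)=\max\{y:(n,y)\in Q\}$. -}

module Defs where

open import Data.Nat using (ℕ; zero; suc; _+_; _∸_; _≤_; _<ᵇ_; _≤ᵇ_; _%_; _≡ᵇ_; _⊔_)
open import Data.Bool using (Bool; true; false; _∧_; _∨_; not; if_then_else_)
open import Data.Product using (_×_)
open import Relation.Binary.PropositionalEquality using (_≡_)

-- Coordinates outside 1..n are meant
-- to be "not in the set" (enforced by hypotheses / definitions below).
VSet : Set
VSet = ℕ → ℕ → Bool

countTo : ℕ → (ℕ → Bool) → ℕ
countTo zero    f = 0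
countTo (suc m) f = countTo m f + (if f (suc m) then 1 else 0)

sumTo : ℕ → (ℕ → ℕ) → ℕ
sumTo zero    f = 0
sumTo (suc m) f = sumTo m f + f (suc m)

maxTo : ℕ → (ℕ → ℕ) → ℕ
maxTo zero    f = 0
maxTo (suc m) f = maxTo m f ⊔ f (suc m)

inRange : ℕ → ℕ → Bool
inRange n x = (1 ≤ᵇ x) ∧ (x ≤ᵇ n)

isEven : ℕ → Bool
isEven k = (k % 2) ≡ᵇ 0

inV1 : ℕ → ℕ → ℕ → Bool
inV1 n x y = inRange n x ∧ inRange n y ∧ isEven (x + y)

SubsetV1 : ℕ → VSet → Set
SubsetV1 n S = ∀ x y → S x y ≡ true → inV1 n x y ≡ true

hasNbrIn : ℕ → VSet → ℕ → ℕ → Bool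
hasNbrIn n S x y =
  ((1 <ᵇ x) ∧ S (x ∸ 1) y) ∨ ((x <ᵇ n) ∧ S (suc x) y) ∨
  ((1 <ᵇ y) ∧ S x (y ∸ 1)) ∨ ((y <ᵇ n) ∧ S x (suc y))

inBoundary : ℕ → VSet → ℕ → ℕ → Bool
inBoundary n S x y = not (S x y) ∧ hasNbrIn n S x y

δ : ℕ → VSet → ℕ
δ n S = sumTo n (λ x → countTo n (λ y → inBoundary n S x y))

Pyramidal : ℕ → VSet → Set
Pyramidal n Q = ∀ x y → Q x y ≡ true → 2 ≤ y →
  (2 ≤ x → Q (x ∸ 1) (y ∸ 1) ≡ true) × (x ≤ n ∸ 1 → Q (suc x) (y ∸ 1) ≡ true)

LeftPyramidal : ℕ → VSet → Set
LeftPyramidal n Q = Pyramidal n Q × (∀ x y → Q x y ≡ true → 3 ≤ x → Q (x ∸ 2) y ≡ true)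

RightPyramidal : ℕ → VSet → Set
RightPyramidal n Q = Pyramidal n Q × (∀ x y → Q x y ≡ true → x ≤ n ∸ 2 → Q (x + 2) y ≡ true)

rowCount : ℕ → VSet → ℕ → ℕ
rowCount n Q i = countTo n (λ x → Q x i)

rankLeft : ℕ → ℕ → ℕ → ℕ
rankLeft n x y = countTo n (λ x' → (x' ≤ᵇ x) ∧ isEven (x' + y))

rankRight : ℕ → ℕ → ℕ → ℕ
rankRight n x y = countTo n (λ x' → (x ≤ᵇ x') ∧ isEven (x' + y))

-- left shifting: row y keeps the r vertices of X_y with smallest x
leftShift : ℕ → VSet → VSet
leftShift n Q x y = inV1 n x y ∧ (rankLeft n x y ≤ᵇ rowCount n Q y)

-- right shifting: row y keeps the r vertices of X_y with largest x
rightShift : ℕ → VSet → VSet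
rightShift n Q x y = inV1 n x y ∧ (rankRight n x y ≤ᵇ rowCount n Q y)

i₁ : ℕ → VSet → ℕ
i₁ n Q = maxTo n (λ y → if Q 1 y then y else 0)

i₂ : ℕ → VSet → ℕ
i₂ n Q = maxTo n (λ y → if Q n y then y else 0)

-- Left shifting replaces every row of
-- a pyramidal Q ⊆ V₁ by the initial segment of the same size of that row's
-- parity class.  Three facts drive the proof.
--   * shifted-support / shifted-cover: if every point of one row set has its
--     neighbours in the next row set, then the initial segments of the same
--     sizes have the same property.  Applied to consecutive rows of Q this
--     makes the shifting pyramidal; at the right border one neighbour is
--     missing, which is compensated by i₂(Q) ≤ i₁(Q) (left-column-below).
--   * For y ≥ 2 the boundary of a pyramidal set in row y is at most its row
--     y ∸ 1, and row y ∸ 1 of Q lies below boundary points of Q; since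
--     shifting keeps row sizes, δ can be compared row by row.  Row 1 is
--     handled by applying shifted-cover to row 1 of Q and its own boundary.
--   * Everything is proved for V_c = {(x , y) : c + x + y even} with an
--     arbitrary offset c; the reflection x ↦ n + 1 ∸ x maps V₁ onto V_{n+1},
--     exchanges i₁ and i₂ and turns left shifting into right shifting, so the
--     right shifting theorem is the mirror image of the left one.

module Submission where

open import Defs
open import Data.Nat using (ℕ; zero; suc; _+_; _∸_; _≤_; _<_; z≤n; s≤s; _≤ᵇ_; _<ᵇ_; _⊓_; ⌊_/2⌋; ⌈_/2⌉)
open import Data.Nat.Properties
open import Data.Bool using (Bool; true; false; _∧_; _∨_; not; if_then_else_; _xor_; T)
open import Data.Bool.Properties using (∧-comm; not-involutive)
open import Data.Product using (_×_; _,_; proj₁; proj₂; ∃)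
open import Data.Sum using (_⊎_; inj₁; inj₂)
open import Data.Empty using (⊥; ⊥-elim)
open import Relation.Binary.PropositionalEquality
open import Relation.Nullary using (¬_; yes; no)

true≢false : ∀ {b} → b ≡ true → b ≡ false → ⊥
true≢false refl ()

b≢not-b : ∀ b → b ≡ not b → ⊥
b≢not-b true ()
b≢not-b false ()

∧-true₁ : ∀ {a b} → a ∧ b ≡ true → a ≡ true
∧-true₁ {true} _ = refl

∧-true₂ : ∀ {a b} → a ∧ b ≡ true → b ≡ true
∧-true₂ {true} p = p

∧-intro : ∀ {a b} → a ≡ true → b ≡ true → a ∧ b ≡ true
∧-intro refl p = p

∨-true-elim : ∀ {a b} → a ∨ b ≡ true → a ≡ true ⊎ b ≡ true
∨-true-elim {true} _ = inj₁ refl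
∨-true-elim {false} p = inj₂ p

∨-intro₁ : ∀ {a b} → a ≡ true → a ∨ b ≡ true
∨-intro₁ refl = refl

∨-intro₂ : ∀ {a b} → b ≡ true → a ∨ b ≡ true
∨-intro₂ {true} _ = refl
∨-intro₂ {false} p = p

¬true⇒false : ∀ {b} → (b ≡ true → ⊥) → b ≡ false
¬true⇒false {true} notTrue = ⊥-elim (notTrue refl)
¬true⇒false {false} _ = refl

not≡false : ∀ {b} → not b ≡ false → b ≡ true
not≡false {true} _ = refl

∧-absorb : ∀ (c u : Bool) → (u ≡ true → c ≡ true) → u ≡ c ∧ u
∧-absorb c true h rewrite h refl = refl
∧-absorb true false h = refl
∧-absorb false false h = refl

∨-swap : ∀ a b r → a ∨ b ∨ r ≡ b ∨ a ∨ r
∨-swap true true r = refl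
∨-swap true false r = refl
∨-swap false true r = refl
∨-swap false false r = refl

suc≤⇒≤∸1 : ∀ {x n} → suc x ≤ n → x ≤ n ∸ 1
suc≤⇒≤∸1 (s≤s p) = p

≤∸1⇒suc≤ : ∀ {x n} → x ≤ n ∸ 1 → 1 ≤ n → suc x ≤ n
≤∸1⇒suc≤ {x} {suc n} p _ = s≤s p

≤ᵇ-complete : ∀ {m n} → m ≤ n → (m ≤ᵇ n) ≡ true
≤ᵇ-complete {m} {n} p with m ≤ᵇ n | ≤⇒≤ᵇ p
... | true | _ = refl

≤ᵇ-sound : ∀ {m n} → (m ≤ᵇ n) ≡ true → m ≤ n
≤ᵇ-sound {m} {n} p = ≤ᵇ⇒≤ m n (subst (λ b → T b) (sym p) _)

<ᵇ-complete : ∀ {m n} → m < n → (m <ᵇ n) ≡ true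
<ᵇ-complete {m} {n} p with m <ᵇ n | <⇒<ᵇ p
... | true | _ = refl

<ᵇ-sound : ∀ {m n} → (m <ᵇ n) ≡ true → m < n
<ᵇ-sound {m} {n} p = <ᵇ⇒< m n (subst (λ b → T b) (sym p) _)

≤ᵇ-false : ∀ {m n} → ¬ (m ≤ n) → (m ≤ᵇ n) ≡ false
≤ᵇ-false {m} {n} m≰n with m ≤ᵇ n in e
... | false = refl
... | true = ⊥-elim (m≰n (≤ᵇ-sound e))

bool-ext : ∀ {a b} → (a ≡ true → b ≡ true) → (b ≡ true → a ≡ true) → a ≡ b
bool-ext {true} f g = sym (f refl)
bool-ext {false} {true} f g = g refl
bool-ext {false} {false} f g = refl

≤ᵇ-cong : ∀ {a b c d} → (a ≤ b → c ≤ d) → (c ≤ d → a ≤ b) → (a ≤ᵇ b) ≡ (c ≤ᵇ d)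
≤ᵇ-cong f g = bool-ext (λ p → ≤ᵇ-complete (f (≤ᵇ-sound p))) (λ p → ≤ᵇ-complete (g (≤ᵇ-sound p)))

<ᵇ-cong : ∀ {a b c d} → (a < b → c < d) → (c < d → a < b) → (a <ᵇ b) ≡ (c <ᵇ d)
<ᵇ-cong f g = bool-ext (λ p → <ᵇ-complete (f (<ᵇ-sound p))) (λ p → <ᵇ-complete (g (<ᵇ-sound p)))

-- Counting and summing over the range 1 … m.  All hypotheses are only
-- required on that range, which is what the grid arguments provide.

indicator : Bool → ℕ
indicator b = if b then 1 else 0

indicator-mono : ∀ {a b} → (a ≡ true → b ≡ true) → indicator a ≤ indicator b
indicator-mono {false} h = z≤n
indicator-mono {true} h rewrite h refl = ≤-refl

indicator≤1 : ∀ b → indicator b ≤ 1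
indicator≤1 true = ≤-refl
indicator≤1 false = z≤n

OnRange : ℕ → (ℕ → Set) → Set
OnRange m P = ∀ i → 1 ≤ i → i ≤ m → P i

restrict : ∀ {m P} → OnRange (suc m) P → OnRange m P
restrict h i i≥1 i≤m = h i i≥1 (m≤n⇒m≤1+n i≤m)

top : ∀ {m P} → OnRange (suc m) P → P (suc m)
top h = h _ (s≤s z≤n) ≤-refl

countTo-ext : ∀ m {f g : ℕ → Bool} → OnRange m (λ i → f i ≡ g i) → countTo m f ≡ countTo m g
countTo-ext zero h = refl
countTo-ext (suc m) h = cong₂ _+_ (countTo-ext m (restrict h)) (cong indicator (top h))

countTo-mono : ∀ m {f g : ℕ → Bool} → OnRange m (λ i → f i ≡ true → g i ≡ true) →
  countTo m f ≤ countTo m g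
countTo-mono zero h = z≤n
countTo-mono (suc m) h = +-mono-≤ (countTo-mono m (restrict h)) (indicator-mono (top h))

countTo≤ : ∀ m f → countTo m f ≤ m
countTo≤ zero f = z≤n
countTo≤ (suc m) f = subst (countTo m f + indicator (f (suc m)) ≤_) (+-comm m 1)
  (+-mono-≤ (countTo≤ m f) (indicator≤1 _))

count-initial : ∀ m r → countTo m (λ k → k ≤ᵇ r) ≡ m ⊓ r
count-initial zero r = refl
count-initial (suc m) r with suc m ≤? r
... | yes m<r rewrite ≤ᵇ-complete m<r | count-initial m r =
  trans (cong (_+ 1) (m≤n⇒m⊓n≡m (≤-trans (n≤1+n m) m<r)))
        (trans (+-comm m 1) (sym (m≤n⇒m⊓n≡m m<r)))
... | no m≮r rewrite ≤ᵇ-false m≮r | count-initial m r =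
  trans (+-identityʳ _) (trans (m≥n⇒m⊓n≡n r≤m) (sym (m≥n⇒m⊓n≡n (m≤n⇒m≤1+n r≤m))))
  where
  r≤m : r ≤ m
  r≤m = ≤-pred (≰⇒> m≮r)

sumTo-ext : ∀ m {f g : ℕ → ℕ} → OnRange m (λ i → f i ≡ g i) → sumTo m f ≡ sumTo m g
sumTo-ext zero h = refl
sumTo-ext (suc m) h = cong₂ _+_ (sumTo-ext m (restrict h)) (top h)

sumTo-mono : ∀ m {f g : ℕ → ℕ} → OnRange m (λ i → f i ≤ g i) → sumTo m f ≤ sumTo m g
sumTo-mono zero h = z≤n
sumTo-mono (suc m) h = +-mono-≤ (sumTo-mono m (restrict h)) (top h)

sumTo-+ : ∀ m (f g : ℕ → ℕ) → sumTo m f + sumTo m g ≡ sumTo m (λ i → f i + g i)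
sumTo-+ zero f g = refl
sumTo-+ (suc m) f g = begin
  (sumTo m f + f (suc m)) + (sumTo m g + g (suc m)) ≡⟨ +-assoc (sumTo m f) _ _ ⟩
  sumTo m f + (f (suc m) + (sumTo m g + g (suc m))) ≡⟨ cong (sumTo m f +_) (+-comm (f (suc m)) _) ⟩
  sumTo m f + ((sumTo m g + g (suc m)) + f (suc m)) ≡⟨ cong (sumTo m f +_) (+-assoc (sumTo m g) _ _) ⟩
  sumTo m f + (sumTo m g + (g (suc m) + f (suc m))) ≡⟨ sym (+-assoc (sumTo m f) _ _) ⟩
  (sumTo m f + sumTo m g) + (g (suc m) + f (suc m)) ≡⟨ cong₂ _+_ (sumTo-+ m f g) (+-comm (g (suc m)) _) ⟩
  sumTo m (λ i → f i + g i) + (f (suc m) + g (suc m)) ∎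
  where open ≡-Reasoning

sumTo-zero : ∀ m → sumTo m (λ _ → 0) ≡ 0
sumTo-zero zero = refl
sumTo-zero (suc m) = trans (+-identityʳ _) (sumTo-zero m)

sumTo-swap : ∀ n m (h : ℕ → ℕ → ℕ) →
  sumTo n (λ x → sumTo m (h x)) ≡ sumTo m (λ y → sumTo n (λ x → h x y))
sumTo-swap zero m h = sym (sumTo-zero m)
sumTo-swap (suc n) m h = trans (cong (_+ sumTo m (h (suc n))) (sumTo-swap n m h))
  (sumTo-+ m (λ y → sumTo n (λ x → h x y)) (h (suc n)))

countTo-as-sum : ∀ m (f : ℕ → Bool) → countTo m f ≡ sumTo m (λ i → indicator (f i))
countTo-as-sum zero f = refl
countTo-as-sum (suc m) f = cong (_+ indicator (f (suc m))) (countTo-as-sum m f)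

sumTo-first : ∀ m (g : ℕ → ℕ) → sumTo (suc m) g ≡ g 1 + sumTo m (λ i → g (suc i))
sumTo-first zero g = +-comm 0 (g 1)
sumTo-first (suc m) g = trans (cong (_+ g (suc (suc m))) (sumTo-first m g)) (+-assoc (g 1) _ _)

sumTo-reverse : ∀ n (f : ℕ → ℕ) → sumTo n f ≡ sumTo n (λ i → f (suc n ∸ i))
sumTo-reverse zero f = refl
sumTo-reverse (suc n) f = sym (begin
  sumTo (suc n) (λ i → f (suc (suc n) ∸ i))    ≡⟨ sumTo-first n (λ i → f (suc (suc n) ∸ i)) ⟩
  f (suc n) + sumTo n (λ i → f (suc n ∸ i))    ≡⟨ cong (f (suc n) +_) (sym (sumTo-reverse n f)) ⟩
  f (suc n) + sumTo n f                         ≡⟨ +-comm (f (suc n)) _ ⟩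
  sumTo n f + f (suc n)                         ∎)
  where open ≡-Reasoning

countTo-reverse : ∀ n (f : ℕ → Bool) → countTo n f ≡ countTo n (λ i → f (suc n ∸ i))
countTo-reverse n f = begin
  countTo n f                                        ≡⟨ countTo-as-sum n f ⟩
  sumTo n (λ i → indicator (f i))                    ≡⟨ sumTo-reverse n _ ⟩
  sumTo n (λ i → indicator (f (suc n ∸ i)))          ≡⟨ sym (countTo-as-sum n _) ⟩
  countTo n (λ i → f (suc n ∸ i))                    ∎
  where open ≡-Reasoning

isEven-suc : ∀ m → isEven (suc m) ≡ not (isEven m)
isEven-suc zero = refl
isEven-suc (suc zero) = refl
isEven-suc (suc (suc m)) = isEven-suc m

isEven-+ : ∀ p e → isEven (p + e) ≡ (if isEven e then isEven p else not (isEven p))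
isEven-+ p zero rewrite +-identityʳ p = refl
isEven-+ p (suc zero) rewrite +-comm p 1 = isEven-suc p
isEven-+ p (suc (suc e)) rewrite +-suc p (suc e) | +-suc p e = isEven-+ p e

isEven-x+x : ∀ x → isEven (x + x) ≡ true
isEven-x+x x rewrite isEven-+ x x with isEven x
... | true = refl
... | false = refl

isEven-+-even : ∀ p e → isEven e ≡ true → isEven (p + e) ≡ isEven p
isEven-+-even p e even rewrite isEven-+ p e | even = refl

twice : ℕ → ℕ
twice zero = zero
twice (suc k) = suc (suc (twice k))

isEven⇒twice : ∀ e → isEven e ≡ true → ∃ λ d → e ≡ twice d
isEven⇒twice zero _ = 0 , refl
isEven⇒twice (suc zero) ()
isEven⇒twice (suc (suc e)) p with isEven⇒twice e p
... | d , refl = suc d , refl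

same-parity-gap : ∀ c w z → w ≤ z → isEven (c + (1 + z)) ≡ isEven (c + (1 + w)) →
  ∃ λ d → z ≡ w + twice d
same-parity-gap c w z w≤z same with m≤n⇒∃[o]m+o≡n w≤z
... | e , refl with isEven e in even-e
... | true with isEven⇒twice e even-e
...   | d , refl = d , refl
same-parity-gap c w z w≤z same | e , refl | false = ⊥-elim (b≢not-b _ (sym (begin
  not b                                           ≡⟨ sym (cong (λ t → if t then b else not b) even-e) ⟩
  (if isEven e then b else not b)                 ≡⟨ sym (isEven-+ (c + (1 + w)) e) ⟩
  isEven (c + (1 + w) + e)                        ≡⟨ cong isEven (+-assoc c (1 + w) e) ⟩
  isEven (c + (1 + w + e))                        ≡⟨ same ⟩
  b                                               ∎)))
  where
  open ≡-Reasoning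
  b : Bool
  b = isEven (c + (1 + w))

twice-mono : ∀ {k m} → k ≤ m → twice k ≤ twice m
twice-mono z≤n = z≤n
twice-mono (s≤s p) = s≤s (s≤s (twice-mono p))

⌊twice/2⌋ : ∀ k → ⌊ twice k /2⌋ ≡ k
⌊twice/2⌋ zero = refl
⌊twice/2⌋ (suc k) = cong suc (⌊twice/2⌋ k)

⌊suc-twice/2⌋ : ∀ k → ⌊ suc (twice k) /2⌋ ≡ k
⌊suc-twice/2⌋ zero = refl
⌊suc-twice/2⌋ (suc k) = cong suc (⌊suc-twice/2⌋ k)

≤⌊/2⌋⇒twice≤ : ∀ k m → k ≤ ⌊ m /2⌋ → twice k ≤ m
≤⌊/2⌋⇒twice≤ zero m _ = z≤n
≤⌊/2⌋⇒twice≤ (suc k) (suc (suc m)) (s≤s p) = s≤s (s≤s (≤⌊/2⌋⇒twice≤ k m p))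

⌈/2⌉-even : ∀ x → isEven x ≡ true → ⌈ x /2⌉ ≡ ⌊ x /2⌋
⌈/2⌉-even zero _ = refl
⌈/2⌉-even (suc zero) ()
⌈/2⌉-even (suc (suc x)) p = cong suc (⌈/2⌉-even x p)

⌈/2⌉-odd : ∀ x → isEven x ≡ false → ⌈ x /2⌉ ≡ suc ⌊ x /2⌋
⌈/2⌉-odd zero ()
⌈/2⌉-odd (suc zero) _ = refl
⌈/2⌉-odd (suc (suc x)) p = cong suc (⌈/2⌉-odd x p)

-- The positions 1 … n split into the odd class
-- (o = true) and the even class (o = false); the k-th member of class o is
-- pos o k, a position x has index ⌈ x /2⌉ within its class, and the class
-- has classSize n o members.  Reindexing turns questions about a row of the
-- grid into questions about initial segments of 1 … classSize n o.

inClass : Bool → ℕ → Bool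
inClass o x = o xor isEven x

pos : Bool → ℕ → ℕ
pos false k = twice k
pos true zero = zero
pos true (suc k) = suc (twice k)

classSize : ℕ → Bool → ℕ
classSize n true = ⌈ n /2⌉
classSize n false = ⌊ n /2⌋

inClass-suc : ∀ o x → inClass o (suc x) ≡ not (inClass o x)
inClass-suc true x rewrite isEven-suc x = refl
inClass-suc false x = isEven-suc x

inClass-not : ∀ o x → inClass (not o) x ≡ not (inClass o x)
inClass-not true x = sym (not-involutive _)
inClass-not false x = refl

inClass-pred : ∀ o x → 1 ≤ x → inClass (not o) (x ∸ 1) ≡ inClass o x
inClass-pred o (suc x) _ rewrite inClass-not o x | inClass-suc o x = refl

inClass-succ : ∀ o x → inClass (not o) (suc x) ≡ inClass o x
inClass-succ o x rewrite inClass-suc (not o) x | inClass-not o x = not-involutive _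

index-pos : ∀ o k → ⌈ pos o k /2⌉ ≡ k
index-pos false k = ⌊suc-twice/2⌋ k
index-pos true zero = refl
index-pos true (suc k) = cong suc (⌊twice/2⌋ k)

pos-index : ∀ o x → inClass o x ≡ true → pos o ⌈ x /2⌉ ≡ x
pos-index false zero _ = refl
pos-index true zero ()
pos-index true (suc zero) _ = refl
pos-index false (suc zero) ()
pos-index false (suc (suc x)) p = cong (λ z → suc (suc z)) (pos-index false x p)
pos-index true (suc (suc zero)) ()
pos-index true (suc (suc (suc x))) p = cong (λ z → suc (suc z)) (pos-index true (suc x) p)

pos≤ : ∀ o k n → 1 ≤ k → k ≤ classSize n o → pos o k ≤ n
pos≤ false k n _ p = ≤⌊/2⌋⇒twice≤ k n p
pos≤ true (suc k) n _ p with ≤⌊/2⌋⇒twice≤ (suc k) (suc n) p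
... | s≤s q = q

pos-mono : ∀ o {k m} → 1 ≤ k → k ≤ m → pos o k ≤ pos o m
pos-mono false _ p = twice-mono p
pos-mono true {suc k} {suc m} _ (s≤s p) = s≤s (twice-mono p)

index≥1 : ∀ x → 1 ≤ x → 1 ≤ ⌈ x /2⌉
index≥1 (suc x) _ = s≤s z≤n

index≤classSize : ∀ o x n → inClass o x ≡ true → x ≤ n → ⌈ x /2⌉ ≤ classSize n o
index≤classSize true x n _ p = ⌈n/2⌉-mono p
index≤classSize false x n c p rewrite ⌈/2⌉-even x c = ⌊n/2⌋-mono p

classSize-suc-in : ∀ o n → inClass o (suc n) ≡ true → classSize (suc n) o ≡ suc (classSize n o)
classSize-suc-in true n p with isEven n in e
... | true = cong suc (sym (⌈/2⌉-even n e))
... | false rewrite isEven-suc n | e = ⊥-elim (true≢false p refl)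
classSize-suc-in false n p with isEven n in e
... | false = ⌈/2⌉-odd n e
... | true rewrite isEven-suc n | e = ⊥-elim (true≢false p refl)

classSize-suc-out : ∀ o n → inClass o (suc n) ≡ false → classSize (suc n) o ≡ classSize n o
classSize-suc-out true n p with isEven n in e
... | false = sym (⌈/2⌉-odd n e)
... | true rewrite isEven-suc n | e = ⊥-elim (true≢false refl p)
classSize-suc-out false n p with isEven n in e
... | true = ⌈/2⌉-even n e
... | false rewrite isEven-suc n | e = ⊥-elim (true≢false refl p)

pos-last : ∀ o n → inClass o n ≡ true → pos o (classSize n o) ≡ n
pos-last true n p = pos-index true n p
pos-last false n p = trans (cong (pos false) (sym (⌈/2⌉-even n p))) (pos-index false n p)

reindex : ∀ n o (f : ℕ → Bool) →
  countTo n (λ x → inClass o x ∧ f x) ≡ countTo (classSize n o) (λ k → f (pos o k))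
reindex zero true f = refl
reindex zero false f = refl
reindex (suc n) o f with inClass o (suc n) in e
... | true rewrite classSize-suc-in o n e
                 | trans (cong (pos o) (sym (classSize-suc-in o n e))) (pos-last o (suc n) e) =
  cong (_+ indicator (f (suc n))) (reindex n o f)
... | false rewrite classSize-suc-out o n e = trans (+-identityʳ _) (reindex n o f)

-- The upper row uses class o,
-- the lower row the opposite class; both are indexed from 1.  For the odd
-- class the upper index k touches the lower indices k ∸ 1 and k, for the
-- even class it touches k and suc k.  A set S of upper indices supports a
-- set T of lower indices if every in-range index touched by a member of S
-- lies in T; this is pyramidality of a pair of rows.

Adjacent : Bool → ℕ → ℕ → Set
Adjacent true j k = suc j ≡ k ⊎ j ≡ k
Adjacent false j k = j ≡ k ⊎ j ≡ suc k

-- The largest lower index touched by upper indices ≤ s.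
reach : Bool → ℕ → ℕ
reach true s = s
reach false s = suc s

adjacent≤reach : ∀ o {j k} → Adjacent o j k → j ≤ reach o k
adjacent≤reach true (inj₁ refl) = n≤1+n _
adjacent≤reach true (inj₂ refl) = ≤-refl
adjacent≤reach false (inj₁ refl) = n≤1+n _
adjacent≤reach false (inj₂ refl) = ≤-refl

reach-mono : ∀ o {k s} → k ≤ s → reach o k ≤ reach o s
reach-mono true p = p
reach-mono false p = s≤s p

Supports : Bool → ℕ → ℕ → (ℕ → Bool) → (ℕ → Bool) → Set
Supports o a b S T = ∀ k j → 1 ≤ k → k ≤ a → S k ≡ true → 1 ≤ j → j ≤ b → Adjacent o j k → T j ≡ true

-- Sizes a and b of the upper and lower class in 1 … n, depending on the
-- upper class o and on whether n itself lies in it.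
ClassSizes : Bool → Bool → ℕ → ℕ → Set
ClassSizes true true a b = a ≡ suc b
ClassSizes true false a b = a ≡ b
ClassSizes false true a b = a ≡ b
ClassSizes false false a b = b ≡ suc a

classSizes-suc² : ∀ o last {a b} → ClassSizes o last a b → ClassSizes o last (suc a) (suc b)
classSizes-suc² true true p = cong suc p
classSizes-suc² true false p = cong suc p
classSizes-suc² false true p = cong suc p
classSizes-suc² false false p = cong suc p

classSizes : ∀ o n → ClassSizes o (inClass o n) (classSize n o) (classSize n (not o))
classSizes true zero = refl
classSizes false zero = refl
classSizes true (suc zero) = refl
classSizes false (suc zero) = refl
classSizes true (suc (suc n)) = classSizes-suc² true (inClass true n) (classSizes true n)
classSizes false (suc (suc n)) = classSizes-suc² false (inClass false n) (classSizes false n)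

countTo-suc-false : ∀ m {f : ℕ → Bool} → f (suc m) ≡ false → countTo (suc m) f ≡ countTo m f
countTo-suc-false m e rewrite e = +-identityʳ _

count-narrowing : ∀ b (S T : ℕ → Bool) →
  OnRange b (λ k → S k ≡ true → T k ≡ true) →
  OnRange b (λ k → S (suc k) ≡ true → T k ≡ true) →
  countTo (suc b) S ≤ countTo b T ⊎ countTo b T ≡ b
count-narrowing zero S T same next = inj₂ refl
count-narrowing (suc b) S T same next = step (count-narrowing b S T (restrict same) (restrict next))
  where
  s t : ℕ
  s = countTo (suc b) S
  t = countTo b T
  step : s ≤ t ⊎ t ≡ b →
    s + indicator (S (suc (suc b))) ≤ t + indicator (T (suc b)) ⊎ t + indicator (T (suc b)) ≡ suc b
  step ih with S (suc (suc b)) in eS | T (suc b) in eT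
  step ih       | true  | false = ⊥-elim (true≢false (top next eS) eT)
  step (inj₁ p) | true  | true  = inj₁ (+-monoˡ-≤ 1 p)
  step (inj₂ q) | _     | true  = inj₂ (trans (cong (_+ 1) q) (+-comm b 1))
  step (inj₁ p) | false | _     = inj₁ (≤-trans (≤-reflexive (+-identityʳ s)) (≤-trans p (m≤m+n t _)))
  step (inj₂ q) | false | false with S (suc b) in eS′
  ... | true  = ⊥-elim (true≢false (top same eS′) eT)
  ... | false = inj₁ (begin
    countTo b S + 0 + 0 ≡⟨ trans (+-identityʳ _) (+-identityʳ _) ⟩
    countTo b S         ≤⟨ countTo≤ b S ⟩
    b                   ≡⟨ sym q ⟩
    t                   ≤⟨ m≤m+n t 0 ⟩
    t + 0               ∎)
    where open ≤-Reasoning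

count-spreading : ∀ a (S T : ℕ → Bool) →
  OnRange a (λ k → S k ≡ true → T k ≡ true × T (suc k) ≡ true) →
  1 ≤ countTo a S → suc (countTo a S) ≤ countTo (suc a) T
count-spreading zero S T spread ()
count-spreading (suc a) S T spread nonempty with S (suc a) in eS
... | false = begin
  suc (countTo a S + 0) ≡⟨ cong suc (+-identityʳ _) ⟩
  suc (countTo a S)     ≤⟨ count-spreading a S T (restrict spread) (subst (1 ≤_) (+-identityʳ _) nonempty) ⟩
  countTo (suc a) T     ≤⟨ m≤m+n _ _ ⟩
  countTo (suc (suc a)) T ∎
  where open ≤-Reasoning
... | true with top spread eS
... | here , next rewrite next with 1 ≤? countTo a S
... | yes p = +-monoˡ-≤ 1 (count-spreading a S T (restrict spread) p)
... | no p rewrite n<1⇒n≡0 (≰⇒> p) | here = +-monoˡ-≤ 1 (+-monoˡ-≤ 1 (z≤n {countTo a T}))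

count-spreading-anchored : ∀ a (S T : ℕ → Bool) → T 1 ≡ true → 1 ≤ a →
  OnRange a (λ k → S k ≡ true → T k ≡ true) →
  (∀ k → 1 ≤ k → suc k ≤ a → S k ≡ true → T (suc k) ≡ true) →
  suc (countTo a S) ≤ countTo a T ⊎ countTo a T ≡ a
count-spreading-anchored (suc zero) S T first _ same next rewrite first = inj₂ refl
count-spreading-anchored (suc (suc a)) S T first _ same next =
  step (count-spreading-anchored (suc a) S T first (s≤s z≤n) (restrict same)
         (λ k p q → next k p (m≤n⇒m≤1+n q)))
  where
  s t : ℕ
  s = countTo (suc a) S
  t = countTo (suc a) T
  step : suc s ≤ t ⊎ t ≡ suc a →
    suc (s + indicator (S (suc (suc a)))) ≤ t + indicator (T (suc (suc a))) ⊎
    t + indicator (T (suc (suc a))) ≡ suc (suc a)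
  step ih with S (suc (suc a)) in eS | T (suc (suc a)) in eT
  step ih       | true  | false = ⊥-elim (true≢false (top same eS) eT)
  step (inj₁ p) | true  | true  = inj₁ (+-monoˡ-≤ 1 p)
  step (inj₂ q) | _     | true  = inj₂ (trans (cong (_+ 1) q) (+-comm (suc a) 1))
  step (inj₁ p) | false | _     =
    inj₁ (≤-trans (≤-reflexive (cong suc (+-identityʳ s))) (≤-trans p (m≤m+n t _)))
  step (inj₂ q) | false | false with S (suc a) in eS′
  ... | true  = ⊥-elim (true≢false (next (suc a) (s≤s z≤n) ≤-refl eS′) eT)
  ... | false = inj₁ (begin
    suc (countTo a S + 0 + 0) ≡⟨ cong suc (trans (+-identityʳ _) (+-identityʳ _)) ⟩
    suc (countTo a S)         ≤⟨ s≤s (countTo≤ a S) ⟩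
    suc a                     ≡⟨ sym q ⟩
    t                         ≤⟨ m≤m+n t 0 ⟩
    t + 0                     ∎)
    where open ≤-Reasoning

-- The extra
-- hypothesis covers the one configuration (even upper class, n even) in
-- which the last upper index has only one lower neighbour.
support-count : ∀ o last a b → ClassSizes o last a b → (S T : ℕ → Bool) → Supports o a b S T →
  (o ≡ false → last ≡ true → S a ≡ true → T 1 ≡ true) →
  1 ≤ countTo a S → reach o (countTo a S) ≤ countTo b T ⊎ countTo b T ≡ b
support-count true true .(suc b) b refl S T sup wrap _ =
  count-narrowing b S T (λ k p q s → sup k k p (m≤n⇒m≤1+n q) s p q (inj₂ refl))
                        (λ k p q s → sup (suc k) k (s≤s z≤n) (s≤s q) s p q (inj₁ refl))
support-count true false a .a refl S T sup wrap _ =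
  inj₁ (countTo-mono a (λ k p q s → sup k k p q s p q (inj₂ refl)))
support-count false false a .(suc a) refl S T sup wrap nonempty =
  inj₁ (count-spreading a S T (λ k p q s → sup k k p q s p (m≤n⇒m≤1+n q) (inj₁ refl) ,
                                           sup k (suc k) p q s (s≤s z≤n) (s≤s q) (inj₂ refl)) nonempty)
support-count false true a .a refl S T sup wrap nonempty with S a in eSa
... | true = count-spreading-anchored a S T (wrap refl refl refl) (≤-trans nonempty (countTo≤ a S))
               (λ k p q s → sup k k p q s p q (inj₁ refl))
               (λ k p q s → sup k (suc k) p (≤-trans (n≤1+n _) q) s (s≤s z≤n) q (inj₂ refl))
support-count false true zero .zero refl S T sup wrap () | false
support-count false true (suc a) .(suc a) refl S T sup wrap nonempty | false =
  inj₁ (subst (λ s → suc s ≤ countTo (suc a) T) (sym dropLast)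
    (count-spreading a S T (λ k p q s → sup k k p (m≤n⇒m≤1+n q) s p (m≤n⇒m≤1+n q) (inj₁ refl) ,
                                        sup k (suc k) p (m≤n⇒m≤1+n q) s (s≤s z≤n) (s≤s q) (inj₂ refl))
                     (subst (1 ≤_) dropLast nonempty)))
  where
  dropLast : countTo (suc a) S ≡ countTo a S
  dropLast = countTo-suc-false a eSa

shifted-support : ∀ o last a b → ClassSizes o last a b → (S T : ℕ → Bool) → Supports o a b S T →
  (o ≡ false → last ≡ true → S a ≡ true → T 1 ≡ true) →
  ∀ k j → 1 ≤ k → k ≤ countTo a S → j ≤ b → Adjacent o j k → j ≤ countTo b T
shifted-support o last a b sizes S T sup wrap k j k≥1 k≤s j≤b adj
  with support-count o last a b sizes S T sup wrap (≤-trans k≥1 k≤s)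
... | inj₁ p = ≤-trans (adjacent≤reach o adj) (≤-trans (reach-mono o k≤s) p)
... | inj₂ full = subst (j ≤_) (sym full) j≤b

-- Both uses below are of this form: row y of a pyramidal set
-- covers row y ∸ 1 shifted by one, and row 1 of any set covers its own
-- boundary in row 1.

Covers : ℕ → (ℕ → Bool) → (ℕ → Bool) → Set
Covers n U L = ∀ x → U x ≡ true → (2 ≤ x → L (x ∸ 1) ≡ true) × (x ≤ n ∸ 1 → L (suc x) ≡ true)

adjacent-pred : ∀ o k → 1 ≤ k → Adjacent o ⌈ pos o k ∸ 1 /2⌉ k
adjacent-pred true (suc k) _ = inj₁ (cong suc (⌊suc-twice/2⌋ k))
adjacent-pred false (suc k) _ = inj₁ (cong suc (⌊twice/2⌋ k))

adjacent-succ : ∀ o k → 1 ≤ k → Adjacent o ⌈ suc (pos o k) /2⌉ k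
adjacent-succ true (suc k) _ = inj₂ (cong suc (⌊suc-twice/2⌋ k))
adjacent-succ false (suc k) _ = inj₂ (cong (λ z → suc (suc z)) (⌊twice/2⌋ k))

covers⇒supports : ∀ n o (U L : ℕ → Bool) → Covers n U L →
  Supports o (classSize n o) (classSize n (not o)) (λ k → U (pos o k)) (λ j → L (pos (not o) j))
covers⇒supports n true U L cov (suc k) .k _ _ uk (s≤s _) _ (inj₁ refl) =
  proj₁ (cov _ uk) (s≤s (s≤s z≤n))
covers⇒supports n true U L cov (suc k) .(suc k) _ _ uk j≥1 j≤b (inj₂ refl) =
  proj₂ (cov _ uk) (suc≤⇒≤∸1 (pos≤ false (suc k) n j≥1 j≤b))
covers⇒supports n false U L cov (suc k) .(suc k) _ _ uk _ _ (inj₁ refl) =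
  proj₁ (cov _ uk) (s≤s (s≤s z≤n))
covers⇒supports n false U L cov (suc k) .(suc (suc k)) _ _ uk j≥1 j≤b (inj₂ refl) =
  proj₂ (cov _ uk) (suc≤⇒≤∸1 (pos≤ true (suc (suc k)) n j≥1 j≤b))

-- The wrap-around
-- hypothesis is the one of support-count, read in positions.
shifted-cover : ∀ n o (U L : ℕ → Bool) →
  (∀ x → U x ≡ true → inClass o x ≡ true) → Covers n U L →
  (o ≡ false → inClass o n ≡ true → U n ≡ true → L 1 ≡ true) →
  ∀ x → 1 ≤ x → x ≤ n → inClass o x ≡ true → ⌈ x /2⌉ ≤ countTo n U →
  ⌈ x ∸ 1 /2⌉ ≤ countTo n (λ z → inClass (not o) z ∧ L z) ×
  (x ≤ n ∸ 1 → ⌈ suc x /2⌉ ≤ countTo n (λ z → inClass (not o) z ∧ L z))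
shifted-cover n o U L classU cov wrap x x≥1 x≤n cx small =
  bound pred≤n (inClass-pred o x x≥1)
        (subst (λ z → Adjacent o ⌈ z ∸ 1 /2⌉ k) atX (adjacent-pred o k k≥1)) ,
  (λ x<n → bound (≤∸1⇒suc≤ x<n (≤-trans x≥1 x≤n)) (inClass-succ o x)
                 (subst (λ z → Adjacent o ⌈ suc z /2⌉ k) atX (adjacent-succ o k k≥1)))
  where
  Uᵢ : ℕ → Bool
  Uᵢ k = U (pos o k)
  Lᵢ : ℕ → Bool
  Lᵢ j = L (pos (not o) j)
  k : ℕ
  k = ⌈ x /2⌉
  k≥1 : 1 ≤ k
  k≥1 = index≥1 x x≥1
  atX : pos o k ≡ x
  atX = pos-index o x cx
  countU : countTo n U ≡ countTo (classSize n o) Uᵢ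
  countU = trans (countTo-ext n (λ z _ _ → ∧-absorb (inClass o z) (U z) (classU z))) (reindex n o U)
  pred≤n : x ∸ 1 ≤ n
  pred≤n = ≤-trans (m∸n≤m x 1) x≤n
  wrapS : o ≡ false → inClass o n ≡ true → Uᵢ (classSize n o) ≡ true → Lᵢ 1 ≡ true
  wrapS refl last s = wrap refl last (subst (λ z → U z ≡ true) (pos-last false n last) s)
  bound : ∀ {z} → z ≤ n → inClass (not o) z ≡ inClass o x → Adjacent o ⌈ z /2⌉ k →
    ⌈ z /2⌉ ≤ countTo n (λ w → inClass (not o) w ∧ L w)
  bound {z} z≤n′ cz adj = subst (⌈ z /2⌉ ≤_) (sym (reindex n (not o) L))
    (shifted-support o (inClass o n) (classSize n o) (classSize n (not o)) (classSizes o n) Uᵢ Lᵢ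
      (covers⇒supports n o U L cov) wrapS k ⌈ z /2⌉ k≥1 (subst (k ≤_) countU small)
      (index≤classSize (not o) z n (trans cz cx) z≤n′) adj)

-- The
-- left shifting theorem is proved for every V_c, so that the right shifting
-- theorem follows from it by the reflection x ↦ n + 1 ∸ x, which maps V₁
-- onto V_{n+1}.  For c = 0 all notions below are the ones of Defs.

inVᶜ : ℕ → ℕ → ℕ → ℕ → Bool
inVᶜ n c x y = inRange n x ∧ inRange n y ∧ isEven (c + (x + y))

SubsetVᶜ : ℕ → ℕ → VSet → Set
SubsetVᶜ n c S = ∀ x y → S x y ≡ true → inVᶜ n c x y ≡ true

rankLeftᶜ : ℕ → ℕ → ℕ → ℕ → ℕ
rankLeftᶜ n c x y = countTo n (λ x′ → (x′ ≤ᵇ x) ∧ isEven (c + (x′ + y)))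

leftShiftᶜ : ℕ → ℕ → VSet → VSet
leftShiftᶜ n c Q x y = inVᶜ n c x y ∧ (rankLeftᶜ n c x y ≤ᵇ rowCount n Q y)

rowClass : ℕ → ℕ → Bool
rowClass c y = not (isEven (c + y))

isEven≡inClass : ∀ c x y → isEven (c + (x + y)) ≡ inClass (rowClass c y) x
isEven≡inClass c zero y with isEven (c + y)
... | true = refl
... | false = refl
isEven≡inClass c (suc x) y
  rewrite +-suc c (x + y) | isEven-suc (c + (x + y)) | isEven≡inClass c x y =
  sym (inClass-suc (rowClass c y) x)

rowClass-pred : ∀ c y → 1 ≤ y → rowClass c (y ∸ 1) ≡ not (rowClass c y)
rowClass-pred c (suc y) _ rewrite +-suc c y | isEven-suc (c + y) = cong not (sym (not-involutive _))

record GridPoint (n c x y : ℕ) : Set where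
  field
    x≥1 : 1 ≤ x
    x≤n : x ≤ n
    y≥1 : 1 ≤ y
    y≤n : y ≤ n
    class : inClass (rowClass c y) x ≡ true

inRange-sound : ∀ {n x} → inRange n x ≡ true → 1 ≤ x × x ≤ n
inRange-sound p = ≤ᵇ-sound (∧-true₁ p) , ≤ᵇ-sound (∧-true₂ p)

inRange-complete : ∀ {n x} → 1 ≤ x → x ≤ n → inRange n x ≡ true
inRange-complete p q = ∧-intro (≤ᵇ-complete p) (≤ᵇ-complete q)

point-isEven : ∀ {n c x y} → GridPoint n c x y → isEven (c + (x + y)) ≡ true
point-isEven {n} {c} {x} {y} g = trans (isEven≡inClass c x y) (GridPoint.class g)

inVᶜ-sound : ∀ {n c x y} → inVᶜ n c x y ≡ true → GridPoint n c x y
inVᶜ-sound {n} {c} {x} {y} p = record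
  { x≥1 = proj₁ (inRange-sound xr) ; x≤n = proj₂ (inRange-sound xr)
  ; y≥1 = proj₁ (inRange-sound yr) ; y≤n = proj₂ (inRange-sound yr)
  ; class = trans (sym (isEven≡inClass c x y)) (∧-true₂ {inRange n y} rest) }
  where
  xr : inRange n x ≡ true
  xr = ∧-true₁ {inRange n x} p
  rest : inRange n y ∧ isEven (c + (x + y)) ≡ true
  rest = ∧-true₂ {inRange n x} p
  yr : inRange n y ≡ true
  yr = ∧-true₁ {inRange n y} rest

inVᶜ-complete : ∀ {n c x y} → GridPoint n c x y → inVᶜ n c x y ≡ true
inVᶜ-complete {n} {c} {x} {y} g = ∧-intro {inRange n x} (inRange-complete x≥1 x≤n)
  (∧-intro {inRange n y} (inRange-complete y≥1 y≤n) (trans (isEven≡inClass c x y) class))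
  where open GridPoint g

rank≡index : ∀ n c x y → 1 ≤ x → x ≤ n → inClass (rowClass c y) x ≡ true → rankLeftᶜ n c x y ≡ ⌈ x /2⌉
rank≡index n c x y x≥1 x≤n cx = begin
  rankLeftᶜ n c x y
    ≡⟨ countTo-ext n (λ i _ _ → trans (∧-comm (i ≤ᵇ x) _) (cong (_∧ (i ≤ᵇ x)) (isEven≡inClass c i y))) ⟩
  countTo n (λ i → inClass o i ∧ (i ≤ᵇ x))
    ≡⟨ reindex n o (λ i → i ≤ᵇ x) ⟩
  countTo (classSize n o) (λ k → pos o k ≤ᵇ x)
    ≡⟨ countTo-ext (classSize n o) (λ k k≥1 _ → ≤ᵇ-cong
         (λ p → subst (_≤ ⌈ x /2⌉) (index-pos o k) (⌈n/2⌉-mono p))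
         (λ p → subst (pos o k ≤_) (pos-index o x cx) (pos-mono o k≥1 p))) ⟩
  countTo (classSize n o) (λ k → k ≤ᵇ ⌈ x /2⌉)
    ≡⟨ count-initial (classSize n o) ⌈ x /2⌉ ⟩
  classSize n o ⊓ ⌈ x /2⌉
    ≡⟨ m≥n⇒m⊓n≡n (index≤classSize o x n cx x≤n) ⟩
  ⌈ x /2⌉ ∎
  where
  open ≡-Reasoning
  o : Bool
  o = rowClass c y

leftShiftᶜ-intro : ∀ n c Q x y → GridPoint n c x y → ⌈ x /2⌉ ≤ rowCount n Q y →
  leftShiftᶜ n c Q x y ≡ true
leftShiftᶜ-intro n c Q x y g small = ∧-intro {inVᶜ n c x y} (inVᶜ-complete g)
  (≤ᵇ-complete (subst (_≤ rowCount n Q y) (sym (rank≡index n c x y x≥1 x≤n class)) small))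
  where open GridPoint g

leftShiftᶜ-elim : ∀ n c Q x y → leftShiftᶜ n c Q x y ≡ true →
  GridPoint n c x y × ⌈ x /2⌉ ≤ rowCount n Q y
leftShiftᶜ-elim n c Q x y p = g ,
  subst (_≤ rowCount n Q y) (rank≡index n c x y x≥1 x≤n class) (≤ᵇ-sound (∧-true₂ {inVᶜ n c x y} p))
  where
  g : GridPoint n c x y
  g = inVᶜ-sound (∧-true₁ p)
  open GridPoint g

boundaryRow : ℕ → VSet → ℕ → ℕ
boundaryRow n S y = countTo n (λ x → inBoundary n S x y)

δ-by-rows : ∀ n S → δ n S ≡ sumTo n (boundaryRow n S)
δ-by-rows n S = begin
  δ n S
    ≡⟨ sumTo-ext n (λ x _ _ → countTo-as-sum n (λ y → inBoundary n S x y)) ⟩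
  sumTo n (λ x → sumTo n (λ y → indicator (inBoundary n S x y)))
    ≡⟨ sumTo-swap n n (λ x y → indicator (inBoundary n S x y)) ⟩
  sumTo n (λ y → sumTo n (λ x → indicator (inBoundary n S x y)))
    ≡⟨ sumTo-ext n (λ y _ _ → sym (countTo-as-sum n (λ x → inBoundary n S x y))) ⟩
  sumTo n (boundaryRow n S) ∎
  where open ≡-Reasoning

data Neighbour (n : ℕ) (S : VSet) (x y : ℕ) : Set where
  left  : 1 < x → S (x ∸ 1) y ≡ true → Neighbour n S x y
  right : x < n → S (suc x) y ≡ true → Neighbour n S x y
  below : 1 < y → S x (y ∸ 1) ≡ true → Neighbour n S x y
  above : y < n → S x (suc y) ≡ true → Neighbour n S x y

neighbour-sound : ∀ n S x y → hasNbrIn n S x y ≡ true → Neighbour n S x y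
neighbour-sound n S x y p with ∨-true-elim {(1 <ᵇ x) ∧ S (x ∸ 1) y} p
... | inj₁ q = left (<ᵇ-sound (∧-true₁ {1 <ᵇ x} q)) (∧-true₂ {1 <ᵇ x} q)
... | inj₂ p₂ with ∨-true-elim {(x <ᵇ n) ∧ S (suc x) y} p₂
... | inj₁ q = right (<ᵇ-sound (∧-true₁ {x <ᵇ n} q)) (∧-true₂ {x <ᵇ n} q)
... | inj₂ p₃ with ∨-true-elim {(1 <ᵇ y) ∧ S x (y ∸ 1)} p₃
... | inj₁ q = below (<ᵇ-sound (∧-true₁ {1 <ᵇ y} q)) (∧-true₂ {1 <ᵇ y} q)
... | inj₂ q = above (<ᵇ-sound (∧-true₁ {y <ᵇ n} q)) (∧-true₂ {y <ᵇ n} q)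

neighbour-complete : ∀ n S x y → Neighbour n S x y → hasNbrIn n S x y ≡ true
neighbour-complete n S x y (left p q) =
  ∨-intro₁ (∧-intro {1 <ᵇ x} (<ᵇ-complete p) q)
neighbour-complete n S x y (right p q) =
  ∨-intro₂ {(1 <ᵇ x) ∧ S (x ∸ 1) y} (∨-intro₁ (∧-intro {x <ᵇ n} (<ᵇ-complete p) q))
neighbour-complete n S x y (below p q) =
  ∨-intro₂ {(1 <ᵇ x) ∧ S (x ∸ 1) y} (∨-intro₂ {(x <ᵇ n) ∧ S (suc x) y}
    (∨-intro₁ (∧-intro {1 <ᵇ y} (<ᵇ-complete p) q)))
neighbour-complete n S x y (above p q) =
  ∨-intro₂ {(1 <ᵇ x) ∧ S (x ∸ 1) y} (∨-intro₂ {(x <ᵇ n) ∧ S (suc x) y}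
    (∨-intro₂ {(1 <ᵇ y) ∧ S x (y ∸ 1)} (∧-intro {y <ᵇ n} (<ᵇ-complete p) q)))

boundary-neighbour : ∀ n S x y → inBoundary n S x y ≡ true → Neighbour n S x y
boundary-neighbour n S x y p = neighbour-sound n S x y (∧-true₂ {not (S x y)} p)

boundary-intro : ∀ n S x y → S x y ≡ false → Neighbour n S x y → inBoundary n S x y ≡ true
boundary-intro n S x y out nb rewrite out = neighbour-complete n S x y nb

-- In a pyramidal set every boundary point (x , y) with y ≥ 2 sits directly
-- above a point of the set (for a neighbour above, go down twice along
-- diagonals), so row y of the boundary is at most row y ∸ 1 of the set.
boundaryRow≤rowBelow : ∀ n P → Pyramidal n P → ∀ y → 2 ≤ y → boundaryRow n P y ≤ rowCount n P (y ∸ 1)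
boundaryRow≤rowBelow n P pyr y y≥2 = countTo-mono n below-in-P
  where
  y≥1 : 1 ≤ y
  y≥1 = ≤-trans (n≤1+n 1) y≥2
  below-in-P : OnRange n (λ x → inBoundary n P x y ≡ true → P x (y ∸ 1) ≡ true)
  below-in-P (suc x) _ x<n b with boundary-neighbour n P (suc x) y b
  ... | left _ q = proj₂ (pyr x y q y≥2) (suc≤⇒≤∸1 x<n)
  ... | right _ q = proj₁ (pyr (suc (suc x)) y q y≥2) (s≤s (s≤s z≤n))
  ... | below _ q = q
  below-in-P (suc zero) _ _ b | above y<n q =
    proj₁ (pyr 2 y (proj₂ (pyr 1 (suc y) q (s≤s y≥1)) (suc≤⇒≤∸1 (≤-trans (s≤s y≥1) y<n))) y≥2)
          (s≤s (s≤s z≤n))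
  below-in-P (suc (suc x)) _ x<n b | above _ q =
    proj₂ (pyr (suc x) y (proj₁ (pyr (suc (suc x)) (suc y) q (s≤s y≥1)) (s≤s (s≤s z≤n))) y≥2)
          (suc≤⇒≤∸1 x<n)

member-point : ∀ {n c S} → SubsetVᶜ n c S → ∀ x y → S x y ≡ true → GridPoint n c x y
member-point {n} {c} sub x y s = inVᶜ-sound {n} {c} {x} {y} (sub x y s)

V-no-adjacent : ∀ {n c x y x′ y′} → GridPoint n c x y → GridPoint n c x′ y′ →
  x′ + y′ ≡ suc (x + y) → ⊥
V-no-adjacent {n} {c} {x} {y} {x′} {y′} g g′ e = true≢false
  (point-isEven g′)
  (begin
    isEven (c + (x′ + y′))     ≡⟨ cong (λ s → isEven (c + s)) e ⟩
    isEven (c + suc (x + y))   ≡⟨ trans (cong isEven (+-suc c (x + y))) (isEven-suc (c + (x + y))) ⟩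
    not (isEven (c + (x + y))) ≡⟨ cong not (point-isEven g) ⟩
    false                      ∎)
  where open ≡-Reasoning

row-covers-boundary : ∀ n c S → SubsetVᶜ n c S → ∀ y →
  Covers n (λ x → S x y) (λ x → inBoundary n S x y)
row-covers-boundary n c S sub y x s =
  (λ { (s≤s (s≤s {n = x′} _)) →
      boundary-intro n S (suc x′) y
        (¬true⇒false (λ s′ → V-no-adjacent (point (suc x′) y s′) (point (suc (suc x′)) y s) refl))
        (right (GridPoint.x≤n (point (suc (suc x′)) y s)) s) }) ,
  (λ x<n → boundary-intro n S (suc x) y
        (¬true⇒false (λ s′ → V-no-adjacent (point x y s) (point (suc x) y s′) refl))
        (left (s≤s (GridPoint.x≥1 (point x y s))) s))
  where
  point : ∀ x y → S x y ≡ true → GridPoint n c x y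
  point = member-point {n} {c} {S} sub

rowBelow≤boundaryRow : ∀ n c S → SubsetVᶜ n c S → ∀ y → 2 ≤ y →
  rowCount n S (y ∸ 1) ≤ boundaryRow n S y
rowBelow≤boundaryRow n c S sub (suc y) (s≤s y≥1) = countTo-mono n above-is-boundary
  where
  point : ∀ x y → S x y ≡ true → GridPoint n c x y
  point = member-point {n} {c} {S} sub
  above-is-boundary : OnRange n (λ x → S x y ≡ true → inBoundary n S x (suc y) ≡ true)
  above-is-boundary x _ _ s = boundary-intro n S x (suc y)
    (¬true⇒false (λ s′ → V-no-adjacent (point x y s) (point x (suc y) s′) (+-suc x y)))
    (below (s≤s y≥1) s)

rowCount-class : ∀ n c S → SubsetVᶜ n c S → ∀ y →
  rowCount n S y ≡ countTo n (λ x → inClass (rowClass c y) x ∧ S x y)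
rowCount-class n c S sub y = countTo-ext n (λ x _ _ →
  ∧-absorb (inClass (rowClass c y) x) (S x y) (λ s → GridPoint.class (member-point {n} {c} {S} sub x y s)))

count-initial-class : ∀ n o t → countTo n (λ x → inClass o x ∧ (⌈ x /2⌉ ≤ᵇ t)) ≡ classSize n o ⊓ t
count-initial-class n o t = begin
  countTo n (λ x → inClass o x ∧ (⌈ x /2⌉ ≤ᵇ t))          ≡⟨ reindex n o (λ x → ⌈ x /2⌉ ≤ᵇ t) ⟩
  countTo (classSize n o) (λ k → ⌈ pos o k /2⌉ ≤ᵇ t)      ≡⟨ countTo-ext (classSize n o)
                                                              (λ k _ _ → cong (_≤ᵇ t) (index-pos o k)) ⟩
  countTo (classSize n o) (λ k → k ≤ᵇ t)                  ≡⟨ count-initial (classSize n o) t ⟩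
  classSize n o ⊓ t                                       ∎
  where open ≡-Reasoning

leftShiftᶜ-row : ∀ n c Q y → 1 ≤ y → y ≤ n →
  OnRange n (λ x → leftShiftᶜ n c Q x y ≡ inClass (rowClass c y) x ∧ (⌈ x /2⌉ ≤ᵇ rowCount n Q y))
leftShiftᶜ-row n c Q y y≥1 y≤n x x≥1 x≤n = bool-ext
  (λ p → let (g , small) = leftShiftᶜ-elim n c Q x y p
         in ∧-intro (GridPoint.class g) (≤ᵇ-complete small))
  (λ p → leftShiftᶜ-intro n c Q x y
           (record { x≥1 = x≥1 ; x≤n = x≤n ; y≥1 = y≥1 ; y≤n = y≤n ; class = ∧-true₁ p })
           (≤ᵇ-sound (∧-true₂ {inClass (rowClass c y) x} p)))

rowCount-leftShiftᶜ : ∀ n c Q → SubsetVᶜ n c Q → ∀ y → 1 ≤ y → y ≤ n →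
  rowCount n (leftShiftᶜ n c Q) y ≡ rowCount n Q y
rowCount-leftShiftᶜ n c Q sub y y≥1 y≤n = begin
  rowCount n (leftShiftᶜ n c Q) y  ≡⟨ countTo-ext n (leftShiftᶜ-row n c Q y y≥1 y≤n) ⟩
  countTo n (λ x → inClass o x ∧ (⌈ x /2⌉ ≤ᵇ r)) ≡⟨ count-initial-class n o r ⟩
  classSize n o ⊓ r                ≡⟨ m≥n⇒m⊓n≡n r≤size ⟩
  r                                ∎
  where
  open ≡-Reasoning
  o : Bool
  o = rowClass c y
  r : ℕ
  r = rowCount n Q y
  r≤size : r ≤ classSize n o
  r≤size = subst (_≤ classSize n o)
    (sym (trans (rowCount-class n c Q sub y) (reindex n o (λ x → Q x y))))
    (countTo≤ (classSize n o) _)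

leftShiftᶜ-leftward : ∀ n c Q x y → leftShiftᶜ n c Q x y ≡ true → 3 ≤ x → leftShiftᶜ n c Q (x ∸ 2) y ≡ true
leftShiftᶜ-leftward n c Q (suc (suc x)) y p (s≤s (s≤s x≥1)) =
  leftShiftᶜ-intro n c Q x y
    (record { x≥1 = x≥1 ; x≤n = ≤-trans (n≤1+n x) (≤-trans (n≤1+n (suc x)) x≤n)
            ; y≥1 = y≥1 ; y≤n = y≤n ; class = class })
    (≤-trans (⌈n/2⌉-mono (≤-trans (n≤1+n x) (n≤1+n (suc x)))) small)
  where
  g : GridPoint n c (suc (suc x)) y
  g = proj₁ (leftShiftᶜ-elim n c Q (suc (suc x)) y p)
  small : ⌈ suc (suc x) /2⌉ ≤ rowCount n Q y
  small = proj₂ (leftShiftᶜ-elim n c Q (suc (suc x)) y p)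
  open GridPoint g using (x≤n; y≥1; y≤n; class)

maxTo-≥ : ∀ m f i → 1 ≤ i → i ≤ m → f i ≤ maxTo m f
maxTo-≥ zero f (suc i) _ ()
maxTo-≥ (suc m) f i i≥1 i≤m with i ≤? m
... | yes p = ≤-trans (maxTo-≥ m f i i≥1 p) (m≤m⊔n _ _)
... | no p rewrite ≤-antisym i≤m (≰⇒> p) = m≤n⊔m (maxTo m f) (f (suc m))

maxTo-attained : ∀ m f → 1 ≤ maxTo m f → ∃ λ i → 1 ≤ i × i ≤ m × maxTo m f ≤ f i
maxTo-attained (suc m) f p with ⊔-sel (maxTo m f) (f (suc m))
... | inj₂ q = suc m , s≤s z≤n , ≤-refl , ≤-reflexive q
... | inj₁ q with maxTo-attained m f (subst (1 ≤_) q p)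
... | i , i≥1 , i≤m , h = i , i≥1 , m≤n⇒m≤1+n i≤m , ≤-trans (≤-reflexive q) h

left-column-reaches : ∀ n Q → i₂ n Q ≤ i₁ n Q → ∀ y → 1 ≤ y → y ≤ n → Q n y ≡ true →
  ∃ λ z → y ≤ z × z ≤ n × Q 1 z ≡ true
left-column-reaches n Q balanced y y≥1 y≤n qn = from-maximum (maxTo-attained n heightLeft (≤-trans y≥1 y≤i₁))
  where
  heightLeft : ℕ → ℕ
  heightLeft z = if Q 1 z then z else 0
  y≤i₁ : y ≤ i₁ n Q
  y≤i₁ = ≤-trans (subst (_≤ i₂ n Q) (cong (λ b → if b then y else 0) qn)
                   (maxTo-≥ n (λ z → if Q n z then z else 0) y y≥1 y≤n)) balanced
  from-maximum : (∃ λ i → 1 ≤ i × i ≤ n × i₁ n Q ≤ heightLeft i) → ∃ λ z → y ≤ z × z ≤ n × Q 1 z ≡ true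
  from-maximum (i , _ , i≤n , h) with Q 1 i in qi
  ... | true = i , ≤-trans y≤i₁ h , i≤n , qi
  ... | false with ≤-trans y≥1 (≤-trans y≤i₁ h)
  ...   | ()

-- In a pyramidal set the left column is closed under going down by two:
-- (1 , z) ∈ P gives (2 , z ∸ 1) ∈ P and then (1 , z ∸ 2) ∈ P.
column-descent : ∀ n P → Pyramidal n P → 2 ≤ n → ∀ d w → 1 ≤ w → P 1 (w + twice d) ≡ true → P 1 w ≡ true
column-descent n P pyr n≥2 zero w w≥1 p = subst (λ z → P 1 z ≡ true) (+-identityʳ w) p
column-descent n P pyr n≥2 (suc d) w w≥1 p = column-descent n P pyr n≥2 d w w≥1 two-lower
  where
  z : ℕ
  z = w + twice d
  top′ : P 1 (suc (suc z)) ≡ true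
  top′ = subst (λ h → P 1 h ≡ true) (trans (+-suc w (suc (twice d))) (cong suc (+-suc w (twice d)))) p
  diagonal : P 2 (suc z) ≡ true
  diagonal = proj₂ (pyr 1 (suc (suc z)) top′ (s≤s (s≤s z≤n))) (suc≤⇒≤∸1 n≥2)
  two-lower : P 1 z ≡ true
  two-lower = proj₁ (pyr 2 (suc z) diagonal (s≤s (≤-trans w≥1 (m≤m+n w _)))) (s≤s (s≤s z≤n))

diagonal-left : ∀ {n c x y} → GridPoint n c x y → 2 ≤ x → 2 ≤ y → GridPoint n c (x ∸ 1) (y ∸ 1)
diagonal-left {n} {c} {x} {y} g x≥2 y≥2 = record
  { x≥1 = suc≤⇒≤∸1 x≥2 ; x≤n = ≤-trans (m∸n≤m x 1) x≤n
  ; y≥1 = suc≤⇒≤∸1 y≥2 ; y≤n = ≤-trans (m∸n≤m y 1) y≤n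
  ; class = trans (cong (λ o → inClass o (x ∸ 1)) (rowClass-pred c y y≥1))
                  (trans (inClass-pred (rowClass c y) x x≥1) class) }
  where open GridPoint g

diagonal-right : ∀ {n c x y} → GridPoint n c x y → x ≤ n ∸ 1 → 2 ≤ y → GridPoint n c (suc x) (y ∸ 1)
diagonal-right {n} {c} {x} {y} g x<n y≥2 = record
  { x≥1 = s≤s z≤n ; x≤n = ≤∸1⇒suc≤ x<n (≤-trans x≥1 x≤n)
  ; y≥1 = suc≤⇒≤∸1 y≥2 ; y≤n = ≤-trans (m∸n≤m y 1) y≤n
  ; class = trans (cong (λ o → inClass o (suc x)) (rowClass-pred c y y≥1))
                  (trans (inClass-succ (rowClass c y) x) class) }
  where open GridPoint g

module LeftShifting (n c : ℕ) (Q : VSet) (sub : SubsetVᶜ n c Q) (pyr : Pyramidal n Q)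
                    (balanced : i₂ n Q ≤ i₁ n Q) where

  Q′ : VSet
  Q′ = leftShiftᶜ n c Q

  point : ∀ x y → Q x y ≡ true → GridPoint n c x y
  point = member-point {n} {c} {Q} sub

  -- This is the only use of
  -- i₂(Q) ≤ i₁(Q): it compensates for the missing right neighbour of n.
  left-column-below : ∀ y → rowClass c y ≡ false → 1 ≤ y → y ≤ n → Q n y ≡ true →
    ∀ w → 1 ≤ w → w ≤ suc y → isEven (c + (1 + w)) ≡ true → Q 1 w ≡ true
  left-column-below y evenRow y≥1 y≤n qn w w≥1 w≤y+1 inV =
    from-column (left-column-reaches n Q balanced y y≥1 y≤n qn)
    where
    -- (1 , y) is not in V_c, since row y has the even class.
    above-row : ∀ z → y ≤ z → Q 1 z ≡ true → y < z
    above-row z y≤z qz with m≤n⇒m<n∨m≡n y≤z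
    ... | inj₁ p = p
    ... | inj₂ refl = ⊥-elim (true≢false (point-isEven (point 1 z qz))
            (trans (cong isEven (+-suc c z)) (trans (isEven-suc (c + z)) (cong not (not≡false evenRow)))))
    from-column : (∃ λ z → y ≤ z × z ≤ n × Q 1 z ≡ true) → Q 1 w ≡ true
    from-column (z , y≤z , z-in , qz)
      with same-parity-gap c w z (≤-trans w≤y+1 y<z) (trans (point-isEven (point 1 z qz)) (sym inV))
      where
      y<z : y < z
      y<z = above-row z y≤z qz
    ... | d , z≡w+2d = column-descent n Q pyr n≥2 d w w≥1 (subst (λ h → Q 1 h ≡ true) z≡w+2d qz)
      where
      n≥2 : 2 ≤ n
      n≥2 = ≤-trans (s≤s y≥1) (≤-trans (above-row z y≤z qz) z-in)

  shifted-row : ∀ y (L : ℕ → Bool) → Covers n (λ x → Q x y) L →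
    (rowClass c y ≡ false → inClass (rowClass c y) n ≡ true → Q n y ≡ true → L 1 ≡ true) →
    ∀ x → Q′ x y ≡ true →
    ⌈ x ∸ 1 /2⌉ ≤ countTo n (λ z → inClass (not (rowClass c y)) z ∧ L z) ×
    (x ≤ n ∸ 1 → ⌈ suc x /2⌉ ≤ countTo n (λ z → inClass (not (rowClass c y)) z ∧ L z))
  shifted-row y L cov wrap x q =
    shifted-cover n (rowClass c y) (λ z → Q z y) L (λ z qz → GridPoint.class (point z y qz)) cov wrap
                  x x≥1 x≤n class small
    where
    g : GridPoint n c x y
    g = proj₁ (leftShiftᶜ-elim n c Q x y q)
    small : ⌈ x /2⌉ ≤ rowCount n Q y
    small = proj₂ (leftShiftᶜ-elim n c Q x y q)
    open GridPoint g using (x≥1; x≤n; class)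

  -- Q′ is pyramidal: row y of Q covers row y ∸ 1 of Q, hence the shifted
  -- rows do as well.
  pyramidal : Pyramidal n Q′
  pyramidal x (suc y) q y≥2 =
    (λ x≥2 → leftShiftᶜ-intro n c Q (x ∸ 1) y (diagonal-left g x≥2 y≥2)
               (subst (⌈ x ∸ 1 /2⌉ ≤_) rowBelow (proj₁ cover))) ,
    (λ x<n → leftShiftᶜ-intro n c Q (suc x) y (diagonal-right g x<n y≥2)
               (subst (⌈ suc x /2⌉ ≤_) rowBelow (proj₂ cover x<n)))
    where
    g : GridPoint n c x (suc y)
    g = proj₁ (leftShiftᶜ-elim n c Q x (suc y) q)
    wrap : rowClass c (suc y) ≡ false → inClass (rowClass c (suc y)) n ≡ true → Q n (suc y) ≡ true → Q 1 y ≡ true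
    wrap evenRow _ qn = left-column-below (suc y) evenRow (s≤s z≤n) (GridPoint.y≤n g) qn y
      (suc≤⇒≤∸1 y≥2) (≤-trans (n≤1+n y) (n≤1+n _)) (not≡false evenRow)
    cover : ⌈ x ∸ 1 /2⌉ ≤ countTo n (λ z → inClass (not (rowClass c (suc y))) z ∧ Q z y) ×
            (x ≤ n ∸ 1 → ⌈ suc x /2⌉ ≤ countTo n (λ z → inClass (not (rowClass c (suc y))) z ∧ Q z y))
    cover = shifted-row (suc y) (λ z → Q z y) (λ z qz → pyr z (suc y) qz y≥2) wrap x q
    rowBelow : countTo n (λ z → inClass (not (rowClass c (suc y))) z ∧ Q z y) ≡ rowCount n Q y
    rowBelow = sym (trans (rowCount-class n c Q sub y)
      (cong (λ o → countTo n (λ z → inClass o z ∧ Q z y)) (rowClass-pred c (suc y) (s≤s z≤n))))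

  -- Row 1.  Row 1 of Q covers the boundary of Q in row 1, so by
  -- shifted-cover row 1 of Q′ covers the first t positions of the opposite
  -- class, t being the number of those boundary points.  Every boundary
  -- point of Q′ in row 1 is a horizontal neighbour of a point of Q′ in row 1
  -- (possibly reached through the point of Q′ above it), hence among them.

  o₁ : Bool
  o₁ = rowClass c 1

  boundary₁ : ℕ → Bool
  boundary₁ z = inBoundary n Q z 1

  t : ℕ
  t = countTo n (λ z → inClass (not o₁) z ∧ boundary₁ z)

  early : ℕ → Bool
  early z = inClass (not o₁) z ∧ (⌈ z /2⌉ ≤ᵇ t)

  -- If row 1 has the even class and (n , 1) ∈ Q, then (1 , 2) ∈ Q and so
  -- (1 , 1) is a boundary point.
  wrap₁ : o₁ ≡ false → inClass o₁ n ≡ true → Q n 1 ≡ true → boundary₁ 1 ≡ true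
  wrap₁ evenRow _ qn = boundary-intro n Q 1 1
    (¬true⇒false (λ q11 → V-no-adjacent (point 1 1 q11) (point 1 2 q12) refl))
    (above (GridPoint.y≤n (point 1 2 q12)) q12)
    where
    q12 : Q 1 2 ≡ true
    q12 = left-column-below 1 evenRow ≤-refl (GridPoint.y≤n (point n 1 qn)) qn 2 (s≤s z≤n) ≤-refl
      (trans (cong isEven (trans (+-suc c 2) (cong suc (+-suc c 1)))) (not≡false evenRow))

  near : Covers n (λ x → Q′ x 1) early
  near x q =
    (λ _ → ∧-intro (trans (inClass-pred o₁ x x≥1) class) (≤ᵇ-complete (proj₁ cover))) ,
    (λ x<n → ∧-intro (trans (inClass-succ o₁ x) class) (≤ᵇ-complete (proj₂ cover x<n)))
    where
    cover : ⌈ x ∸ 1 /2⌉ ≤ t × (x ≤ n ∸ 1 → ⌈ suc x /2⌉ ≤ t)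
    cover = shifted-row 1 boundary₁ (row-covers-boundary n c Q sub 1) wrap₁ x q
    open GridPoint (proj₁ (leftShiftᶜ-elim n c Q x 1 q)) using (x≥1; class)

  boundary-early : OnRange n (λ z → inBoundary n Q′ z 1 ≡ true → early z ≡ true)
  boundary-early z _ _ b with boundary-neighbour n Q′ z 1 b
  boundary-early (suc z) _ z≤n′ _ | left _ q = proj₂ (near z q) (suc≤⇒≤∸1 z≤n′)
  boundary-early z z≥1 _ _ | right _ q = proj₁ (near (suc z) q) (s≤s z≥1)
  boundary-early z _ _ _ | below (s≤s ()) _
  boundary-early (suc zero) _ _ _ | above _ q =
    proj₁ (near 2 (proj₂ (pyramidal 1 2 q ≤-refl) (suc≤⇒≤∸1 n≥2))) ≤-refl
    where
    n≥2 : 2 ≤ n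
    n≥2 = GridPoint.y≤n (proj₁ (leftShiftᶜ-elim n c Q 1 2 q))
  boundary-early (suc (suc z)) _ z≤n′ _ | above _ q =
    proj₂ (near (suc z) (proj₁ (pyramidal (suc (suc z)) 2 q ≤-refl) (s≤s (s≤s z≤n)))) (suc≤⇒≤∸1 z≤n′)

  boundaryRow₁ : boundaryRow n Q′ 1 ≤ boundaryRow n Q 1
  boundaryRow₁ = begin
    boundaryRow n Q′ 1        ≤⟨ countTo-mono n boundary-early ⟩
    countTo n early           ≡⟨ count-initial-class n (not o₁) t ⟩
    classSize n (not o₁) ⊓ t  ≤⟨ m⊓n≤n _ _ ⟩
    t                         ≤⟨ countTo-mono n (λ z _ _ → ∧-true₂ {inClass (not o₁) z}) ⟩
    boundaryRow n Q 1         ∎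
    where open ≤-Reasoning

  -- Rows y ≥ 2: the boundary of Q′ in row y is at most row y ∸ 1 of Q′,
  -- which has the size of row y ∸ 1 of Q, which lies below boundary points of Q.
  boundaryRow-bound : OnRange n (λ y → boundaryRow n Q′ y ≤ boundaryRow n Q y)
  boundaryRow-bound (suc zero) _ _ = boundaryRow₁
  boundaryRow-bound (suc (suc y)) _ y≤n = begin
    boundaryRow n Q′ (suc (suc y)) ≤⟨ boundaryRow≤rowBelow n Q′ pyramidal (suc (suc y)) (s≤s (s≤s z≤n)) ⟩
    rowCount n Q′ (suc y)          ≡⟨ rowCount-leftShiftᶜ n c Q sub (suc y) (s≤s z≤n) (≤-trans (n≤1+n _) y≤n) ⟩
    rowCount n Q (suc y)           ≤⟨ rowBelow≤boundaryRow n c Q sub (suc (suc y)) (s≤s (s≤s z≤n)) ⟩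
    boundaryRow n Q (suc (suc y))  ∎
    where open ≤-Reasoning

  theorem : LeftPyramidal n Q′ × δ n Q′ ≤ δ n Q
  theorem = (pyramidal , leftShiftᶜ-leftward n c Q) , (begin
    δ n Q′                     ≡⟨ δ-by-rows n Q′ ⟩
    sumTo n (boundaryRow n Q′) ≤⟨ sumTo-mono n boundaryRow-bound ⟩
    sumTo n (boundaryRow n Q)  ≡⟨ sym (δ-by-rows n Q) ⟩
    δ n Q                      ∎)
    where open ≤-Reasoning

mirror : ℕ → ℕ → ℕ
mirror n x = suc n ∸ x

reflect : ℕ → VSet → VSet
reflect n S x y = S (mirror n x) y

mirror-suc : ∀ {x n} → x ≤ n → mirror n x ≡ suc (n ∸ x)
mirror-suc p = +-∸-assoc 1 p

mirror-pred : ∀ {n x} → 1 ≤ x → x ≤ suc n → mirror n (x ∸ 1) ≡ suc (mirror n x)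
mirror-pred {n} {suc x} _ (s≤s x≤n) = mirror-suc x≤n

mirror-succ : ∀ n x → mirror n (suc x) ≡ mirror n x ∸ 1
mirror-succ n x = sym (trans (∸-+-assoc (suc n) x 1) (cong (suc n ∸_) (+-comm x 1)))

mirror-in-range : ∀ {n x} → 1 ≤ x → x ≤ n → 1 ≤ mirror n x × mirror n x ≤ n
mirror-in-range {n} {suc x} _ (s≤s x≤n) = subst (1 ≤_) (sym (mirror-suc x≤n)) (s≤s z≤n) , m∸n≤m n x

mirror-in-range⁻¹ : ∀ n x → 1 ≤ mirror n x → mirror n x ≤ n → 1 ≤ x × x ≤ n
mirror-in-range⁻¹ n zero _ q = ⊥-elim (1+n≰n q)
mirror-in-range⁻¹ n (suc x) p _ = s≤s z≤n , lt n x p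
  where
  lt : ∀ n x → 1 ≤ n ∸ x → suc x ≤ n
  lt (suc n) zero _ = s≤s z≤n
  lt (suc n) (suc x) p = s≤s (lt n x p)
  lt zero x p with subst (1 ≤_) (0∸n≡0 x) p
  ... | ()

isEven-mirror : ∀ n x y → x ≤ suc n → isEven (suc n + (x + y)) ≡ isEven (mirror n x + y)
isEven-mirror n x y x≤n+1 = begin
  isEven (suc n + (x + y))                       ≡⟨ cong isEven shuffle ⟩
  isEven ((m + y) + (x + x))                     ≡⟨ isEven-+-even (m + y) (x + x) (isEven-x+x x) ⟩
  isEven (m + y)                                 ∎
  where
  open ≡-Reasoning
  m : ℕ
  m = mirror n x
  shuffle : suc n + (x + y) ≡ (m + y) + (x + x)
  shuffle = begin
    suc n + (x + y)        ≡⟨ cong (_+ (x + y)) (sym (m∸n+n≡m x≤n+1)) ⟩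
    m + x + (x + y)        ≡⟨ +-assoc m x (x + y) ⟩
    m + (x + (x + y))      ≡⟨ cong (m +_) (trans (sym (+-assoc x x y)) (+-comm (x + x) y)) ⟩
    m + (y + (x + x))      ≡⟨ sym (+-assoc m y (x + x)) ⟩
    m + y + (x + x)        ∎

reflect-subset : ∀ n Q → SubsetV1 n Q → SubsetVᶜ n (suc n) (reflect n Q)
reflect-subset n Q sub x y q = inVᶜ-complete {n} {suc n} {x} {y} (record
  { x≥1 = proj₁ x-in ; x≤n = proj₂ x-in ; y≥1 = y≥1 ; y≤n = y≤n
  ; class = trans (sym (isEven≡inClass (suc n) x y))
                  (trans (isEven-mirror n x y (≤-trans (proj₂ x-in) (n≤1+n n))) (point-isEven g)) })
  where
  g : GridPoint n 0 (mirror n x) y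
  g = member-point {n} {0} {Q} sub (mirror n x) y q
  open GridPoint g using (y≥1; y≤n)
  x-in : 1 ≤ x × x ≤ n
  x-in = mirror-in-range⁻¹ n x (GridPoint.x≥1 g) (GridPoint.x≤n g)

<ᵇ-mirror-left : ∀ n x → 1 ≤ x → x ≤ n → (1 <ᵇ x) ≡ (mirror n x <ᵇ n)
<ᵇ-mirror-left n (suc x) _ x<n = <ᵇ-cong
  (λ { (s≤s x≥1) → ∸-monoʳ-< {n} {x} {0} x≥1 (≤-trans (n≤1+n x) x<n) })
  (from-mirror x)
  where
  from-mirror : ∀ x → n ∸ x < n → 1 < suc x
  from-mirror zero p = ⊥-elim (<-irrefl refl p)
  from-mirror (suc x) _ = s≤s (s≤s z≤n)

<ᵇ-mirror-right : ∀ n x → x ≤ n → (x <ᵇ n) ≡ (1 <ᵇ mirror n x)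
<ᵇ-mirror-right n x x≤n = <ᵇ-cong
  (λ p → subst (1 <_) (sym (mirror-suc {x} {n} x≤n)) (s≤s (m+n≤o⇒m≤o∸n 1 p)))
  (λ p → m≤o∸n⇒m+n≤o 1 x≤n (≤-pred (subst (1 <_) (mirror-suc x≤n) p)))

-- Reflection maps boundary points to boundary points: the left and right
-- neighbours are exchanged, the vertical ones are kept.
boundary-reflect : ∀ n S x y → 1 ≤ x → x ≤ n →
  inBoundary n (reflect n S) x y ≡ inBoundary n S (mirror n x) y
boundary-reflect n S x y x≥1 x≤n = cong (not (S m y) ∧_) (begin
  leftR ∨ rightR ∨ vertical
    ≡⟨ cong₂ (λ u v → u ∨ v ∨ vertical)
             (cong₂ _∧_ (<ᵇ-mirror-left n x x≥1 x≤n) (cong (λ z → S z y) (mirror-pred x≥1 (≤-trans x≤n (n≤1+n n)))))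
             (cong₂ _∧_ (<ᵇ-mirror-right n x x≤n) (cong (λ z → S z y) (mirror-succ n x))) ⟩
  ((m <ᵇ n) ∧ S (suc m) y) ∨ ((1 <ᵇ m) ∧ S (m ∸ 1) y) ∨ vertical
    ≡⟨ ∨-swap ((m <ᵇ n) ∧ S (suc m) y) ((1 <ᵇ m) ∧ S (m ∸ 1) y) vertical ⟩
  hasNbrIn n S m y ∎)
  where
  open ≡-Reasoning
  m : ℕ
  m = mirror n x
  leftR rightR vertical : Bool
  leftR = (1 <ᵇ x) ∧ S (mirror n (x ∸ 1)) y
  rightR = (x <ᵇ n) ∧ S (mirror n (suc x)) y
  vertical = ((1 <ᵇ y) ∧ S m (y ∸ 1)) ∨ ((y <ᵇ n) ∧ S m (suc y))

δ-reflect : ∀ n S → δ n (reflect n S) ≡ δ n S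
δ-reflect n S = begin
  δ n (reflect n S)
    ≡⟨ sumTo-ext n (λ x x≥1 x≤n → countTo-ext n (λ y _ _ → boundary-reflect n S x y x≥1 x≤n)) ⟩
  sumTo n (λ x → countTo n (λ y → inBoundary n S (mirror n x) y))
    ≡⟨ sym (sumTo-reverse n (λ x → countTo n (λ y → inBoundary n S x y))) ⟩
  δ n S ∎
  where open ≡-Reasoning

inRange-mirror : ∀ n x → inRange n (mirror n x) ≡ inRange n x
inRange-mirror n x = bool-ext
  (λ p → let (m≥1 , m≤n) = inRange-sound p
             (x≥1 , x≤n) = mirror-in-range⁻¹ n x m≥1 m≤n in inRange-complete x≥1 x≤n)
  (λ p → let (x≥1 , x≤n) = inRange-sound p
             (m≥1 , m≤n) = mirror-in-range {n} {x} x≥1 x≤n in inRange-complete m≥1 m≤n)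

InColumns : ℕ → VSet → Set
InColumns n P = ∀ x y → P x y ≡ true → 1 ≤ x × x ≤ n

-- Pyramidality is symmetric under the reflection: the two lower diagonal
-- neighbours are exchanged.
pyramidal-reflect : ∀ n P → Pyramidal n P → InColumns n P → Pyramidal n (reflect n P)
pyramidal-reflect n P pyr cols zero y q _ = ⊥-elim (1+n≰n (proj₂ (cols _ y q)))
pyramidal-reflect n P pyr cols (suc x) y q y≥2 =
  (λ { (s≤s x≥1) → subst (λ z → P z (y ∸ 1) ≡ true) (sym (mirror-suc x≤n))
                     (proj₂ (pyr (n ∸ x) y q y≥2) (∸-monoʳ-≤ n x≥1)) }) ,
  (λ x<n → subst (λ z → P z (y ∸ 1) ≡ true) (sym (mirror-succ n (suc x)))
             (proj₁ (pyr (n ∸ x) y q y≥2)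
               (m+n≤o⇒m≤o∸n 2 (≤∸1⇒suc≤ x<n (≤-trans (s≤s z≤n) (proj₂ x-in))))))
  where
  x-in : 1 ≤ suc x × suc x ≤ n
  x-in = mirror-in-range⁻¹ n (suc x) (proj₁ (cols _ y q)) (proj₂ (cols _ y q))
  x≤n : x ≤ n
  x≤n = ≤-trans (n≤1+n x) (proj₂ x-in)

three≤mirror : ∀ n x → 1 ≤ x → x ≤ n ∸ 2 → 3 ≤ mirror n x
three≤mirror (suc (suc n)) (suc x) _ p = m+n≤o⇒m≤o∸n 3 {x} (s≤s (s≤s p))
three≤mirror zero (suc x) _ ()
three≤mirror (suc zero) (suc x) _ ()

rightPyramidal-reflect : ∀ n L → LeftPyramidal n L → InColumns n L → RightPyramidal n (reflect n L)
rightPyramidal-reflect n L (pyr , leftward) cols = pyramidal-reflect n L pyr cols , rightward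
  where
  rightward : ∀ x y → L (mirror n x) y ≡ true → x ≤ n ∸ 2 → L (mirror n (x + 2)) y ≡ true
  rightward x y q p = subst (λ z → L z y ≡ true) (∸-+-assoc (suc n) x 2)
    (leftward (mirror n x) y q
      (three≤mirror n x (proj₁ (mirror-in-range⁻¹ n x (proj₁ (cols _ y q)) (proj₂ (cols _ y q)))) p))

_≐_ : VSet → VSet → Set
S ≐ S′ = ∀ x y → S x y ≡ S′ x y

δ-≐ : ∀ {n S S′} → S ≐ S′ → δ n S ≡ δ n S′
δ-≐ {n} {S} {S′} e = sumTo-ext n (λ x _ _ → countTo-ext n (λ y _ _ → boundary-≐ x y))
  where
  boundary-≐ : ∀ x y → inBoundary n S x y ≡ inBoundary n S′ x y
  boundary-≐ x y rewrite e x y | e (x ∸ 1) y | e (suc x) y | e x (y ∸ 1) | e x (suc y) = refl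

rightPyramidal-≐ : ∀ {n S S′} → S ≐ S′ → RightPyramidal n S′ → RightPyramidal n S
rightPyramidal-≐ {n} {S} {S′} e (pyr , rightward) =
  (λ x y q y≥2 → let (l , r) = pyr x y (to q) y≥2 in (λ p → from (l p)) , (λ p → from (r p))) ,
  (λ x y q p → from (rightward x y (to q) p))
  where
  to : ∀ {x y} → S x y ≡ true → S′ x y ≡ true
  to {x} {y} q = trans (sym (e x y)) q
  from : ∀ {x y} → S′ x y ≡ true → S x y ≡ true
  from {x} {y} q = trans (e x y) q

≤-mirror-swap : ∀ n x z → x ≤ suc n → z ≤ suc n → (x ≤ᵇ mirror n z) ≡ (z ≤ᵇ mirror n x)
≤-mirror-swap n x z x≤ z≤ = ≤ᵇ-cong
  (λ p → m+n≤o⇒m≤o∸n z (subst (_≤ suc n) (+-comm x z) (m≤o∸n⇒m+n≤o x z≤ p)))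
  (λ p → m+n≤o⇒m≤o∸n x (subst (_≤ suc n) (+-comm z x) (m≤o∸n⇒m+n≤o z x≤ p)))

-- The right shifting theorem, as the mirror image of the left one: the
-- right shifting of Q is the reflection of the left shifting of the
-- reflection R of Q, a pyramidal subset of V_{n+1} with i₂(R) = i₁(Q) and
-- i₁(R) = i₂(Q).

module RightShifting (n : ℕ) (Q : VSet) (sub : SubsetV1 n Q) (pyr : Pyramidal n Q)
                     (balanced : i₁ n Q ≤ i₂ n Q) where

  R : VSet
  R = reflect n Q

  columnsQ : InColumns n Q
  columnsQ x y q = GridPoint.x≥1 g , GridPoint.x≤n g
    where
    g : GridPoint n 0 x y
    g = member-point {n} {0} {Q} sub x y q

  -- i₁(R) is i₂(Q) by definition, and i₂(R) is i₁(Q) since mirror n n = 1.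
  balancedR : i₂ n R ≤ i₁ n R
  balancedR = subst (λ h → maxTo n (λ y → if Q h y then y else 0) ≤ i₂ n Q) (sym (m+n∸n≡m 1 n)) balanced

  open LeftShifting n (suc n) R (reflect-subset n Q sub) (pyramidal-reflect n Q pyr columnsQ) balancedR
    using (Q′) renaming (theorem to mirrored)

  columnsQ′ : InColumns n Q′
  columnsQ′ x y q = GridPoint.x≥1 g , GridPoint.x≤n g
    where
    g : GridPoint n (suc n) x y
    g = proj₁ (leftShiftᶜ-elim n (suc n) R x y q)

  rank-mirror : ∀ x y → x ≤ n → rankRight n x y ≡ rankLeftᶜ n (suc n) (mirror n x) y
  rank-mirror x y x≤n = trans (countTo-reverse n _) (countTo-ext n (λ z _ z≤n′ →
    cong₂ _∧_ (≤-mirror-swap n x z (≤-trans x≤n (n≤1+n n)) (≤-trans z≤n′ (n≤1+n n)))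
              (sym (isEven-mirror n z y (≤-trans z≤n′ (n≤1+n n))))))

  -- Right shifting is reflected left shifting of the reflection; outside
  -- the columns 1 … n both sides are empty.
  rightShift≐ : rightShift n Q ≐ reflect n Q′
  rightShift≐ x y with inRange n x in inX
  ... | false rewrite inRange-mirror n x | inX = refl
  ... | true rewrite inRange-mirror n x | inX =
    cong₂ _∧_ (cong (inRange n y ∧_) parity)
              (cong₂ _≤ᵇ_ (rank-mirror x y x≤n) (countTo-reverse n (λ z → Q z y)))
    where
    x≤n : x ≤ n
    x≤n = proj₂ (inRange-sound inX)
    parity : isEven (x + y) ≡ isEven (suc n + (mirror n x + y))
    parity = sym (trans (isEven-mirror n (mirror n x) y (m∸n≤m (suc n) x))
                        (cong (λ z → isEven (z + y)) (m∸[m∸n]≡n (≤-trans x≤n (n≤1+n n)))))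

  theorem : RightPyramidal n (rightShift n Q) × δ n (rightShift n Q) ≤ δ n Q
  theorem = rightPyramidal-≐ {n} rightShift≐ (rightPyramidal-reflect n Q′ (proj₁ mirrored) columnsQ′) , (begin
    δ n (rightShift n Q)   ≡⟨ δ-≐ {n} rightShift≐ ⟩
    δ n (reflect n Q′)     ≡⟨ δ-reflect n Q′ ⟩
    δ n Q′                 ≤⟨ proj₂ mirrored ⟩
    δ n R                  ≡⟨ δ-reflect n Q ⟩
    δ n Q                  ∎)
    where open ≤-Reasoning

lemma6 : (n : ℕ) (Q : VSet) → SubsetV1 n Q → Pyramidal n Q →
    (i₂ n Q ≤ i₁ n Q →
      LeftPyramidal n (leftShift n Q) × δ n (leftShift n Q) ≤ δ n Q) ×
    (i₁ n Q ≤ i₂ n Q →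
      RightPyramidal n (rightShift n Q) × δ n (rightShift n Q) ≤ δ n Q)
lemma6 n Q sub pyr =
  (λ balanced → LeftShifting.theorem n 0 Q sub pyr balanced) ,
  (λ balanced → RightShifting.theorem n Q sub pyr balanced)
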